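{- For every finite simple graph $\Gamma$ there exists a finite abelian group $G$ such that $\Gamma$ is isomorphic to an induced subgraph of the difference graph $D(G)$.
   Context: For a group $G$, the power graph $\mathsf{Pow}(G)$ has vertex set $G$, with distinct $a,b$ adjacent iff $a\in\langle b\rangle$ or $b\in\langle a\rangle$. The enhanced power graph $\mathsf{EPow}(G)$ has vertex set $G$, with distinct $a,b$ adjacent iff $\langle a,b\rangle$ is cyclic. The difference graph $D(G)$ is the graph $\mathsf{EPow}(G)-\mathsf{Pow}(G)$ (vertex set $G$, edges those of $\mathsf{EPow}(G)$ that are not edges of $\mathsf{Pow}(G)$) with all isolated vertices removed. Thus $x\sim y$ in $D(G)$ iff $\langle x,y\rangle$ is cyclic, $x\notin\langle y\rangle$ and $y\notin\langle x\rangle$. -}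

module Defs where

open import Level using (Level; _⊔_)
open import Data.Nat using (ℕ; zero; suc)
open import Data.Integer using (ℤ; +_; -[1+_])
open import Data.Fin using (Fin)
open import Data.Bool using (Bool; true; false)
open import Data.Product using (Σ; ∃; _×_; _,_)
open import Relation.Nullary using (¬_)
open import Relation.Binary.PropositionalEquality using (_≡_)
open import Function.Bundles using (_⇔_)
open import Algebra.Bundles using (AbelianGroup)

record SimpleGraph (n : ℕ) : Set where
  field
    adj   : Fin n → Fin n → Bool
    sym   : ∀ i j → adj i j ≡ adj j i
    irrefl : ∀ i → adj i i ≡ false

record FiniteAbelianGroup (c ℓ : Level) : Set (Level.suc (c ⊔ ℓ)) where
  field
    abGroup : AbelianGroup c ℓ
  open AbelianGroup abGroup using (Carrier; _≈_)
  field
    size      : ℕ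
    enum      : Fin size → Carrier
    enum-surj : ∀ x → ∃ λ i → enum i ≈ x

module DifferenceGraph {c ℓ : Level} (G : AbelianGroup c ℓ) where
  open AbelianGroup G

  powℕ : Carrier → ℕ → Carrier
  powℕ x zero    = ε
  powℕ x (suc k) = x ∙ powℕ x k

  pow : Carrier → ℤ → Carrier
  pow x (+ k)     = powℕ x k
  pow x -[1+ k ]  = (powℕ x (suc k)) ⁻¹

  InCyclic : Carrier → Carrier → Set ℓ
  InCyclic a b = ∃ λ (k : ℤ) → a ≈ pow b k

  -- z ∈ ⟨x , y⟩  (G abelian, so ⟨x,y⟩ = { x^a y^b })
  InGen2 : Carrier → Carrier → Carrier → Set ℓ
  InGen2 z x y = ∃ λ (a : ℤ) → ∃ λ (b : ℤ) → z ≈ (pow x a ∙ pow y b)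

  CyclicGen2 : Carrier → Carrier → Set (c ⊔ ℓ)
  CyclicGen2 x y = ∃ λ g → (InCyclic x g × InCyclic y g) × InGen2 g x y

  -- adjacency in EPow(G) − Pow(G)
  DAdj : Carrier → Carrier → Set (c ⊔ ℓ)
  DAdj x y = ¬ (x ≈ y) × CyclicGen2 x y × ¬ InCyclic x y × ¬ InCyclic y x

  -- vertices of D(G): the non-isolated ones
  InD : Carrier → Set (c ⊔ ℓ)
  InD x = ∃ λ y → DAdj x y

InducedSubgraphOfD : ∀ {c ℓ} {n : ℕ} → SimpleGraph n → AbelianGroup c ℓ → Set (c ⊔ ℓ)
InducedSubgraphOfD {n = n} Γ G =
  Σ (Fin n → Carrier) λ f →
      (∀ i j → f i ≈ f j → i ≡ j)
    × (∀ i → InD (f i))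
    × (∀ i j → (SimpleGraph.adj Γ i j ≡ true) ⇔ DAdj (f i) (f j))
  where
  open AbelianGroup G
  open DifferenceGraph G

-- Add an apex adjacent to every vertex, so that every vertex has a neighbour in D(G).
-- Choose moduli m_pq = m_qp from the Sylvester sequence (pairwise coprime, none a unit) and
-- let G = ∏_{p,q} ℤ/m_pq. Vertex i goes to the indicator x_i of the coordinates (i , q)
-- with q not adjacent to i; in particular x_i is 1 at (i , i), where every x_j with j ≠ i
-- vanishes, so x_i ∉ ⟨x_j⟩. For a non-edge {i , j} the coordinates (i , j), (j , i) form a
-- copy of (ℤ/m)² in which x_i, x_j are the standard basis vectors, which lie in no cyclic
-- subgroup. For an edge the supports of x_i and x_j carry disjoint sets of moduli, so by the
-- Chinese remainder theorem some c is ≡ 1 on the support of x_i and ≡ 0 on that of x_j;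
-- then x_i = c (x_i + x_j), likewise for x_j, and ⟨x_i , x_j⟩ = ⟨x_i + x_j⟩.
module Submission where

open import Level using (0ℓ; _⊔_)
open import Algebra.Bundles using (AbelianGroup)
open import Data.Bool using (Bool; true; false)
open import Data.Empty using (⊥-elim)
open import Data.Fin using (Fin; zero; suc; toℕ; fromℕ<; combine; remQuot)
open import Data.Fin.Properties
  using (_≟_; _≤?_; ≤-antisym; ≤-total; suc-injective; toℕ-injective; toℕ<n; toℕ-fromℕ<; combine-injective; remQuot-combine)
open import Data.Integer using (ℤ; +_; -[1+_]; _+_; _*_; -_; _-_; 0ℤ; 1ℤ; -1ℤ)
open import Data.Integer.Base using (_%ℕ_; _/ℕ_)
open import Data.Integer.DivMod using (a≡a%ℕn+[a/ℕn]*n; n%ℕd<d)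
open import Data.Integer.Divisibility.Signed
  using (_∣_; divides; ∣⇒∣ᵤ; ∣-refl; ∣m∣n⇒∣m+n; ∣m⇒∣-m; ∣n⇒∣m*n; ∣m⇒∣m*n)
open import Data.Integer.Properties
  using ( +-assoc; +-comm; +-identityˡ; +-identityʳ; +-inverseˡ; +-inverseʳ; *-identityʳ; *-zeroʳ
        ; pos-+; pos-*; neg-distribˡ-*; suc-*)
open import Data.Integer.Tactic.RingSolver using (solve-∀)
open import Data.Nat as ℕ using (ℕ; zero; suc; NonZero)
import Data.Nat.Properties as ℕ
open import Data.Nat.Divisibility using (∣1⇒≡1)
open import Data.Product using (Σ; ∃; _×_; _,_; proj₁; proj₂; swap)
open import Data.Sum using (_⊎_; inj₁; inj₂)
open import Data.Vec.Functional using (foldr)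
open import Function using (_∘_)
open import Function.Bundles using (mk⇔)
open import Relation.Binary.Core using (Rel)
open import Relation.Binary.Definitions using (tri<; tri≈; tri>)
open import Relation.Binary.PropositionalEquality
  using (_≡_; _≢_; refl; sym; trans; cong; subst; subst₂; module ≡-Reasoning)
import Relation.Binary.Reasoning.Setoid as SetoidReasoning
open import Relation.Nullary using (¬_; yes; no)
open import Defs

infix 4 _≡_[mod_]

record _≡_[mod_] (x y m : ℤ) : Set where
  constructor ≡-mod
  field ∣-difference : m ∣ x - y

module _ {m : ℤ} where

  ≡-mod-reflexive : ∀ {x y} → x ≡ y → x ≡ y [mod m ]
  ≡-mod-reflexive {x} refl = ≡-mod (divides 0ℤ (+-inverseʳ x))

  ≡-mod-refl : ∀ {x} → x ≡ x [mod m ]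
  ≡-mod-refl = ≡-mod-reflexive refl

  ≡-mod-sym : ∀ {x y} → x ≡ y [mod m ] → y ≡ x [mod m ]
  ≡-mod-sym {x} {y} (≡-mod d) = ≡-mod (subst (m ∣_) (lemma x y) (∣m⇒∣-m d))
    where
    lemma : ∀ x y → - (x - y) ≡ y - x
    lemma = solve-∀

  ≡-mod-trans : ∀ {x y z} → x ≡ y [mod m ] → y ≡ z [mod m ] → x ≡ z [mod m ]
  ≡-mod-trans {x} {y} {z} (≡-mod d) (≡-mod e) = ≡-mod (subst (m ∣_) (lemma x y z) (∣m∣n⇒∣m+n d e))
    where
    lemma : ∀ x y z → (x - y) + (y - z) ≡ x - z
    lemma = solve-∀

  +-cong-mod : ∀ {x x′ y y′} → x ≡ x′ [mod m ] → y ≡ y′ [mod m ] → x + y ≡ x′ + y′ [mod m ]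
  +-cong-mod {x} {x′} {y} {y′} (≡-mod d) (≡-mod e) =
    ≡-mod (subst (m ∣_) (lemma x x′ y y′) (∣m∣n⇒∣m+n d e))
    where
    lemma : ∀ x x′ y y′ → (x - x′) + (y - y′) ≡ (x + y) - (x′ + y′)
    lemma = solve-∀

  neg-cong-mod : ∀ {x x′} → x ≡ x′ [mod m ] → - x ≡ - x′ [mod m ]
  neg-cong-mod {x} {x′} (≡-mod d) = ≡-mod (subst (m ∣_) (lemma x x′) (∣m⇒∣-m d))
    where
    lemma : ∀ x x′ → - (x - x′) ≡ (- x) - (- x′)
    lemma = solve-∀

  *-cong-mod : ∀ {x x′ y y′} → x ≡ x′ [mod m ] → y ≡ y′ [mod m ] → x * y ≡ x′ * y′ [mod m ]
  *-cong-mod {x} {x′} {y} {y′} (≡-mod d) (≡-mod e) =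
    ≡-mod (subst (m ∣_) (lemma x x′ y y′) (∣m∣n⇒∣m+n (∣m⇒∣m*n y d) (∣n⇒∣m*n x′ e)))
    where
    lemma : ∀ x x′ y y′ → (x - x′) * y + x′ * (y - y′) ≡ x * y - x′ * y′
    lemma = solve-∀

  *-congˡ-mod : ∀ x {y y′} → y ≡ y′ [mod m ] → x * y ≡ x * y′ [mod m ]
  *-congˡ-mod x = *-cong-mod (≡-mod-refl {x})

  *-congʳ-mod : ∀ y {x x′} → x ≡ x′ [mod m ] → x * y ≡ x′ * y [mod m ]
  *-congʳ-mod y x≡x′ = *-cong-mod x≡x′ (≡-mod-refl {y})

  ∣⇒≡0-mod : ∀ {x} → m ∣ x → x ≡ 0ℤ [mod m ]
  ∣⇒≡0-mod {x} = ≡-mod ∘ subst (m ∣_) (sym (+-identityʳ x))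

ℤ/_ : ℤ → AbelianGroup 0ℓ 0ℓ
ℤ/ m = record
  { Carrier = ℤ
  ; _≈_ = λ x y → x ≡ y [mod m ]
  ; _∙_ = _+_
  ; ε = 0ℤ
  ; _⁻¹ = -_
  ; isAbelianGroup = record
    { isGroup = record
      { isMonoid = record
        { isSemigroup = record
          { isMagma = record
            { isEquivalence = record { refl = ≡-mod-refl ; sym = ≡-mod-sym ; trans = ≡-mod-trans }
            ; ∙-cong = +-cong-mod
            }
          ; assoc = λ x y z → ≡-mod-reflexive (+-assoc x y z)
          }
        ; identity = (≡-mod-reflexive ∘ +-identityˡ) , (≡-mod-reflexive ∘ +-identityʳ)
        }
      ; inverse = (≡-mod-reflexive ∘ +-inverseˡ) , (≡-mod-reflexive ∘ +-inverseʳ)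
      ; ⁻¹-cong = neg-cong-mod
      }
    ; comm = λ x y → ≡-mod-reflexive (+-comm x y)
    }
  }

module ≡-mod-Reasoning (m : ℤ) = SetoidReasoning (AbelianGroup.setoid (ℤ/ m))

-- (1 , 0) and (0 , 1) are multiples of no common (g , g′) in (ℤ/m)², unless m is a unit.
standard-basis-not-cyclic : ∀ {m} a b g g′ →
  1ℤ ≡ a * g [mod m ] → 0ℤ ≡ b * g [mod m ] → 1ℤ ≡ b * g′ [mod m ] → 1ℤ ≡ 0ℤ [mod m ]
standard-basis-not-cyclic {m} a b g g′ 1≡ag 0≡bg 1≡bg′ = begin
  1ℤ      ≈⟨ 1≡bg′ ⟩
  b * g′  ≈⟨ *-congʳ-mod g′ b≡0 ⟩
  0ℤ * g′ ≡⟨⟩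
  0ℤ      ∎
  where
  open ≡-mod-Reasoning m
  exchange : ∀ a b g → b * (a * g) ≡ a * (b * g)
  exchange = solve-∀
  b≡0 : b ≡ 0ℤ [mod m ]
  b≡0 = begin
    b           ≡⟨ *-identityʳ b ⟨
    b * 1ℤ      ≈⟨ *-congˡ-mod b 1≡ag ⟩
    b * (a * g) ≡⟨ exchange a b g ⟩
    a * (b * g) ≈⟨ *-congˡ-mod a (≡-mod-sym 0≡bg) ⟩
    a * 0ℤ      ≡⟨ *-zeroʳ a ⟩
    0ℤ          ∎

∏ : ∀ {n} → (Fin n → ℤ) → ℤ
∏ = foldr _*_ 1ℤ

∏≡1-mod : ∀ {m n} (f : Fin n → ℤ) → (∀ k → f k ≡ 1ℤ [mod m ]) → ∏ f ≡ 1ℤ [mod m ]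
∏≡1-mod {n = zero}  f _ = ≡-mod-refl
∏≡1-mod {n = suc n} f f≡1 = *-cong-mod (f≡1 zero) (∏≡1-mod (f ∘ suc) (f≡1 ∘ suc))

∏≡0-mod : ∀ {m n} (f : Fin n → ℤ) k → f k ≡ 0ℤ [mod m ] → ∏ f ≡ 0ℤ [mod m ]
∏≡0-mod {n = suc n} f zero    fk≡0 = *-congʳ-mod (∏ (f ∘ suc)) fk≡0
∏≡0-mod {n = suc n} f (suc k) fk≡0 =
  ≡-mod-trans (*-congˡ-mod (f zero) (∏≡0-mod (f ∘ suc) k fk≡0)) (≡-mod-reflexive (*-zeroʳ (f zero)))

Π-abelianGroup : ∀ {a c ℓ} {I : Set a} → (I → AbelianGroup c ℓ) → AbelianGroup (a ⊔ c) (a ⊔ ℓ)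
Π-abelianGroup {I = I} G = record
  { Carrier = (i : I) → Gᵢ.Carrier i
  ; _≈_ = λ x y → ∀ i → Gᵢ._≈_ i (x i) (y i)
  ; _∙_ = λ x y i → Gᵢ._∙_ i (x i) (y i)
  ; ε = Gᵢ.ε
  ; _⁻¹ = λ x i → Gᵢ._⁻¹ i (x i)
  ; isAbelianGroup = record
    { isGroup = record
      { isMonoid = record
        { isSemigroup = record
          { isMagma = record
            { isEquivalence = record
              { refl = λ i → Gᵢ.refl i
              ; sym = λ x≈y i → Gᵢ.sym i (x≈y i)
              ; trans = λ x≈y y≈z i → Gᵢ.trans i (x≈y i) (y≈z i)
              }
            ; ∙-cong = λ x≈x′ y≈y′ i → Gᵢ.∙-cong i (x≈x′ i) (y≈y′ i)
            }
          ; assoc = λ x y z i → Gᵢ.assoc i (x i) (y i) (z i)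
          }
        ; identity = (λ x i → Gᵢ.identityˡ i (x i)) , (λ x i → Gᵢ.identityʳ i (x i))
        }
      ; inverse = (λ x i → Gᵢ.inverseˡ i (x i)) , (λ x i → Gᵢ.inverseʳ i (x i))
      ; ⁻¹-cong = λ x≈y i → Gᵢ.⁻¹-cong i (x≈y i)
      }
    ; comm = λ x y i → Gᵢ.comm i (x i) (y i)
    }
  }
  where module Gᵢ (i : I) = AbelianGroup (G i)

module _ {a c ℓ} {I : Set a} (G : I → AbelianGroup c ℓ) where
  private
    module Π = DifferenceGraph (Π-abelianGroup G)
    module Gᵢ (i : I) = DifferenceGraph (G i)

  powℕ-Π : ∀ x k i → Π.powℕ x k i ≡ Gᵢ.powℕ i (x i) k
  powℕ-Π x zero    i = refl
  powℕ-Π x (suc k) i = cong (AbelianGroup._∙_ (G i) (x i)) (powℕ-Π x k i)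

  pow-Π : ∀ x k i → Π.pow x k i ≡ Gᵢ.pow i (x i) k
  pow-Π x (+ k)     i = powℕ-Π x k i
  pow-Π x -[1+ k ]  i = cong (AbelianGroup._⁻¹ (G i)) (powℕ-Π x (suc k) i)

module _ (m : ℤ) where
  open DifferenceGraph (ℤ/ m)

  powℕ-ℤ/ : ∀ x k → powℕ x k ≡ + k * x
  powℕ-ℤ/ x zero    = refl
  powℕ-ℤ/ x (suc k) = trans (cong (_+_ x) (powℕ-ℤ/ x k)) (sym (suc-* (+ k) x))

  pow-ℤ/ : ∀ x k → pow x k ≡ k * x
  pow-ℤ/ x (+ k)    = powℕ-ℤ/ x k
  pow-ℤ/ x -[1+ k ] = trans (cong -_ (powℕ-ℤ/ x (suc k))) (neg-distribˡ-* (+ suc k) x)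

record Enumeration {a ℓ} {A : Set a} (_≈_ : Rel A ℓ) : Set (a ⊔ ℓ) where
  field
    size      : ℕ
    enum      : Fin size → A
    enum-surj : ∀ x → ∃ λ i → enum i ≈ x

open Enumeration

Π-enumeration : ∀ {a ℓ} n {A : Fin n → Set a} (R : ∀ i → Rel (A i) ℓ) →
  (∀ i → Enumeration (R i)) → Enumeration {A = ∀ i → A i} (λ f g → ∀ i → R i (f i) (g i))
Π-enumeration zero    R E = record { size = 1 ; enum = λ _ () ; enum-surj = λ f → zero , λ () }
Π-enumeration (suc n) {A} R E = record
  { size = size head ℕ.* size tail
  ; enum = enumPair
  ; enum-surj = λ f → combine (index₀ f) (index₊ f) , enumPair-combine f
  }
  where
  head : Enumeration (R zero)
  head = E zero
  tail : Enumeration {A = ∀ i → A (suc i)} (λ f g → ∀ i → R (suc i) (f i) (g i))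
  tail = Π-enumeration n (R ∘ suc) (E ∘ suc)
  enumPair : Fin (size head ℕ.* size tail) → ∀ i → A i
  enumPair k zero    = enum head (proj₁ (remQuot {size head} (size tail) k))
  enumPair k (suc i) = enum tail (proj₂ (remQuot {size head} (size tail) k)) i
  index₀ : (∀ i → A i) → Fin (size head)
  index₀ f = proj₁ (enum-surj head (f zero))
  index₊ : (∀ i → A i) → Fin (size tail)
  index₊ f = proj₁ (enum-surj tail (f ∘ suc))
  enumPair-combine : ∀ f i → R i (enumPair (combine (index₀ f) (index₊ f)) i) (f i)
  enumPair-combine f zero = subst (λ p → R zero (enum head (proj₁ p)) (f zero))
    (sym (remQuot-combine (index₀ f) (index₊ f))) (proj₂ (enum-surj head (f zero)))
  enumPair-combine f (suc i) = subst (λ p → R (suc i) (enum tail (proj₂ p) i) (f (suc i)))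
    (sym (remQuot-combine (index₀ f) (index₊ f))) (proj₂ (enum-surj tail (f ∘ suc)) i)

enumeration : ∀ {c ℓ} (G : FiniteAbelianGroup c ℓ) → Enumeration (AbelianGroup._≈_ (FiniteAbelianGroup.abGroup G))
enumeration G = record
  { size = FiniteAbelianGroup.size G
  ; enum = FiniteAbelianGroup.enum G
  ; enum-surj = FiniteAbelianGroup.enum-surj G
  }

Π-finite : ∀ n → (Fin n → FiniteAbelianGroup 0ℓ 0ℓ) → FiniteAbelianGroup 0ℓ 0ℓ
Π-finite n G = record
  { abGroup = Π-abelianGroup (abGroup ∘ G)
  ; size = size product
  ; enum = enum product
  ; enum-surj = enum-surj product
  }
  where
  open FiniteAbelianGroup using (abGroup)
  product : Enumeration (AbelianGroup._≈_ (Π-abelianGroup (abGroup ∘ G)))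
  product = Π-enumeration n (λ i → AbelianGroup._≈_ (abGroup (G i))) (enumeration ∘ G)

-- ℤ/(k+1)
ℤ/-finite : ℕ → FiniteAbelianGroup 0ℓ 0ℓ
ℤ/-finite k = record
  { abGroup = ℤ/ (+ n)
  ; size = n
  ; enum = λ r → + toℕ r
  ; enum-surj = λ z → fromℕ< (n%ℕd<d z n) , remainder≡ z
  }
  where
  n = suc k
  remainder≡ : ∀ z → + toℕ (fromℕ< (n%ℕd<d z n)) ≡ z [mod + n ]
  remainder≡ z rewrite toℕ-fromℕ< (n%ℕd<d z n) = ≡-mod (divides (- (z /ℕ n)) (begin
    + (z %ℕ n) - z                           ≡⟨ cong (λ w → + (z %ℕ n) - w) (a≡a%ℕn+[a/ℕn]*n z n) ⟩
    + (z %ℕ n) - (+ (z %ℕ n) + z /ℕ n * + n) ≡⟨ lemma (+ (z %ℕ n)) (z /ℕ n) (+ n) ⟩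
    - (z /ℕ n) * + n                         ∎))
    where
    open ≡-Reasoning
    lemma : ∀ r q d → r - (r + q * d) ≡ - q * d
    lemma = solve-∀

-- Sylvester's sequence: sylvester t = 1 + ∏_{u<t} sylvester u.
sylvesterProduct : ℕ → ℕ
sylvesterProduct zero    = 1
sylvesterProduct (suc t) = sylvesterProduct t ℕ.* suc (sylvesterProduct t)

sylvester : ℕ → ℤ
sylvester t = + suc (sylvesterProduct t)

sylvesterProduct-nonZero : ∀ t → NonZero (sylvesterProduct t)
sylvesterProduct-nonZero zero    = _
sylvesterProduct-nonZero (suc t) =
  ℕ.m*n≢0 (sylvesterProduct t) (suc (sylvesterProduct t)) {{sylvesterProduct-nonZero t}}

sylvester≡product+1 : ∀ t → sylvester t ≡ + sylvesterProduct t + 1ℤ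
sylvester≡product+1 t = trans (cong +_ (ℕ.+-comm 1 (sylvesterProduct t))) (pos-+ (sylvesterProduct t) 1)

sylvesterProduct-suc : ∀ t → + sylvesterProduct (suc t) ≡ + sylvesterProduct t * sylvester t
sylvesterProduct-suc t = pos-* (sylvesterProduct t) (suc (sylvesterProduct t))

sylvester∣sylvesterProduct : ∀ {u t} → u ℕ.< t → sylvester u ∣ + sylvesterProduct t
sylvester∣sylvesterProduct {u} {suc t} u<1+t =
  subst (sylvester u ∣_) (sym (sylvesterProduct-suc t)) (divides-step (ℕ.m<1+n⇒m<n∨m≡n u<1+t))
  where
  divides-step : u ℕ.< t ⊎ u ≡ t → sylvester u ∣ + sylvesterProduct t * sylvester t
  divides-step (inj₁ u<t)  = ∣m⇒∣m*n (sylvester t) (sylvester∣sylvesterProduct u<t)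
  divides-step (inj₂ refl) = ∣n⇒∣m*n (+ sylvesterProduct t) ∣-refl

sylvester≡1 : ∀ {u t} → u ℕ.< t → sylvester t ≡ 1ℤ [mod sylvester u ]
sylvester≡1 {u} {t} u<t = ≡-mod (subst (sylvester u ∣_) product≡sylvester-1 (sylvester∣sylvesterProduct u<t))
  where
  lemma : ∀ p → p ≡ (p + 1ℤ) - 1ℤ
  lemma = solve-∀
  product≡sylvester-1 : + sylvesterProduct t ≡ sylvester t - 1ℤ
  product≡sylvester-1 = trans (lemma (+ sylvesterProduct t)) (cong (_- 1ℤ) (sym (sylvester≡product+1 t)))

sylvesterProduct≡-1 : ∀ t → + sylvesterProduct t ≡ -1ℤ [mod sylvester t ]
sylvesterProduct≡-1 t =
  ≡-mod (subst (sylvester t ∣_) (trans (sylvester≡product+1 t) (lemma (+ sylvesterProduct t))) ∣-refl)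
  where
  lemma : ∀ p → p + 1ℤ ≡ p - (- 1ℤ)
  lemma = solve-∀

1≢0-mod-sylvester : ∀ t → ¬ 1ℤ ≡ 0ℤ [mod sylvester t ]
1≢0-mod-sylvester t (≡-mod d) =
  ℕ.≢-nonZero⁻¹ (sylvesterProduct t) {{sylvesterProduct-nonZero t}} (ℕ.suc-injective (∣1⇒≡1 (∣⇒∣ᵤ d)))

sylvesterTail : ℕ → ℕ → ℤ
sylvesterTail t zero    = 1ℤ
sylvesterTail t (suc k) = sylvesterTail t k * sylvester (suc (t ℕ.+ k))

sylvesterTail≡1 : ∀ t k → sylvesterTail t k ≡ 1ℤ [mod sylvester t ]
sylvesterTail≡1 t zero    = ≡-mod-refl
sylvesterTail≡1 t (suc k) = *-cong-mod (sylvesterTail≡1 t k) (sylvester≡1 (ℕ.s≤s (ℕ.m≤m+n t k)))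

sylvester∣sylvesterTail : ∀ {u} t k → t ℕ.< u → u ℕ.≤ t ℕ.+ k → sylvester u ∣ sylvesterTail t k
sylvester∣sylvesterTail t zero    t<u u≤t+0 =
  ⊥-elim (ℕ.<⇒≱ t<u (ℕ.≤-trans u≤t+0 (ℕ.≤-reflexive (ℕ.+-identityʳ t))))
sylvester∣sylvesterTail t (suc k) t<u u≤t+k+1
  with ℕ.m≤n⇒m<n∨m≡n (ℕ.≤-trans u≤t+k+1 (ℕ.≤-reflexive (ℕ.+-suc t k)))
... | inj₁ u<t+k+1 = ∣m⇒∣m*n _ (sylvester∣sylvesterTail t k t<u (ℕ.s≤s⁻¹ u<t+k+1))
... | inj₂ refl    = ∣n⇒∣m*n (sylvesterTail t k) ∣-refl

-- A Chinese-remainder idempotent: modulo sylvester t the product ∏_{u<t} sylvester u is ≡ -1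
-- and sylvesterTail t k is ≡ 1, while modulo any other sylvester u with u ≤ t + k one factor is ≡ 0.
idempotent : ℕ → ℕ → ℤ
idempotent t k = 1ℤ + + sylvesterProduct t * sylvesterTail t k

idempotent≡0 : ∀ t k → idempotent t k ≡ 0ℤ [mod sylvester t ]
idempotent≡0 t k = +-cong-mod (≡-mod-refl {x = 1ℤ}) (*-cong-mod (sylvesterProduct≡-1 t) (sylvesterTail≡1 t k))

idempotent≡1 : ∀ {u} t k → u ≢ t → u ℕ.≤ t ℕ.+ k → idempotent t k ≡ 1ℤ [mod sylvester u ]
idempotent≡1 {u} t k u≢t u≤t+k with ℕ.<-cmp u t
... | tri< u<t _ _ =
  +-cong-mod (≡-mod-refl {x = 1ℤ})
    (*-congʳ-mod (sylvesterTail t k) (∣⇒≡0-mod (sylvester∣sylvesterProduct u<t)))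
... | tri≈ _ u≡t _ = ⊥-elim (u≢t u≡t)
... | tri> _ _ t<u = +-cong-mod (≡-mod-refl {x = 1ℤ}) (≡-mod-trans
  (*-congˡ-mod (+ sylvesterProduct t) (∣⇒≡0-mod (sylvester∣sylvesterTail t k t<u u≤t+k)))
  (≡-mod-reflexive (*-zeroʳ (+ sylvesterProduct t))))

pairIndex : ∀ {N} → Fin N → Fin N → Fin (N ℕ.* N)
pairIndex p q with p ≤? q
... | yes _ = combine p q
... | no  _ = combine q p

pairIndex-sym : ∀ {N} (p q : Fin N) → pairIndex p q ≡ pairIndex q p
pairIndex-sym p q with p ≤? q | q ≤? p
... | yes p≤q | yes q≤p = subst (λ r → combine p r ≡ combine r p) (≤-antisym p≤q q≤p) refl
... | yes _   | no  _   = refl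
... | no  _   | yes _   = refl
... | no  p≰q | no  q≰p with ≤-total p q
...   | inj₁ p≤q = ⊥-elim (p≰q p≤q)
...   | inj₂ q≤p = ⊥-elim (q≰p q≤p)

pairIndex-injective : ∀ {N} (p q r s : Fin N) → pairIndex p q ≡ pairIndex r s →
  (p ≡ r × q ≡ s) ⊎ (p ≡ s × q ≡ r)
pairIndex-injective p q r s eq with p ≤? q | r ≤? s
... | yes _ | yes _ = inj₁ (combine-injective p q r s eq)
... | yes _ | no  _ = inj₂ (combine-injective p q s r eq)
... | no  _ | yes _ = inj₂ (swap (combine-injective q p r s eq))
... | no  _ | no  _ = inj₁ (swap (combine-injective q p s r eq))

module DifferenceEmbedding {N : ℕ} (Γ : SimpleGraph N) where
  open SimpleGraph Γ renaming (sym to adj-sym)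

  pairIndexℕ : Fin N → Fin N → ℕ
  pairIndexℕ p q = toℕ (pairIndex p q)

  modulus : Fin N → Fin N → ℤ
  modulus p q = sylvester (pairIndexℕ p q)

  modulus-sym : ∀ p q → modulus p q ≡ modulus q p
  modulus-sym p q = cong (sylvester ∘ toℕ) (pairIndex-sym p q)

  group : FiniteAbelianGroup 0ℓ 0ℓ
  group = Π-finite N λ p → Π-finite N λ q → ℤ/-finite (sylvesterProduct (pairIndexℕ p q))

  open AbelianGroup (FiniteAbelianGroup.abGroup group)
    using (Carrier; _≈_; _∙_; ∙-cong; identityʳ) renaming (refl to ≈-refl; sym to ≈-sym; trans to ≈-trans)
  open DifferenceGraph (FiniteAbelianGroup.abGroup group)

  pow-pointwise : ∀ x k p q → pow x k p q ≡ k * x p q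
  pow-pointwise x k p q = begin
    pow x k p q                               ≡⟨ cong (λ y → y q) (pow-Π row x k p) ⟩
    DifferenceGraph.pow (row p) (x p) k q     ≡⟨ pow-Π (entry p) (x p) k q ⟩
    DifferenceGraph.pow (entry p q) (x p q) k ≡⟨ pow-ℤ/ (modulus p q) (x p q) k ⟩
    k * x p q                                 ∎
    where
    open ≡-Reasoning
    entry : Fin N → Fin N → AbelianGroup 0ℓ 0ℓ
    entry p q = ℤ/ modulus p q
    row : Fin N → AbelianGroup 0ℓ 0ℓ
    row p = Π-abelianGroup (entry p)

  nonAdjacency : Bool → ℤ
  nonAdjacency true  = 0ℤ
  nonAdjacency false = 1ℤ

  embed : Fin N → Carrier
  embed i p q with p ≟ i
  ... | yes _ = nonAdjacency (adj i q)
  ... | no  _ = 0ℤ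

  embed-row : ∀ i q → embed i i q ≡ nonAdjacency (adj i q)
  embed-row i q with i ≟ i
  ... | yes _   = refl
  ... | no  i≢i = ⊥-elim (i≢i refl)

  embed-off : ∀ i p q → p ≢ i → embed i p q ≡ 0ℤ
  embed-off i p q p≢i with p ≟ i
  ... | yes p≡i = ⊥-elim (p≢i p≡i)
  ... | no  _   = refl

  embed-nonadjacent : ∀ {i q} → adj i q ≡ false → embed i i q ≡ 1ℤ
  embed-nonadjacent {i} {q} i≁q = trans (embed-row i q) (cong nonAdjacency i≁q)

  ≈pow⇒≡*-mod : ∀ {x} g c → x ≈ pow g c → ∀ p q → x p q ≡ c * g p q [mod modulus p q ]
  ≈pow⇒≡*-mod g c x≈gᶜ p q = ≡-mod-trans (x≈gᶜ p q) (≡-mod-reflexive (pow-pointwise g c p q))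

  ≡*-mod⇒≈pow : ∀ {x} g c → (∀ p q → x p q ≡ c * g p q [mod modulus p q ]) → x ≈ pow g c
  ≡*-mod⇒≈pow g c x≡cg p q = ≡-mod-trans (x≡cg p q) (≡-mod-reflexive (sym (pow-pointwise g c p q)))

  embed-∉ : ∀ {i j} → i ≢ j → ¬ InCyclic (embed i) (embed j)
  embed-∉ {i} {j} i≢j (k , i≈jᵏ) = 1≢0-mod-sylvester (pairIndexℕ i i) (begin
    1ℤ              ≡⟨ embed-nonadjacent (irrefl i) ⟨
    embed i i i     ≈⟨ ≈pow⇒≡*-mod (embed j) k i≈jᵏ i i ⟩
    k * embed j i i ≡⟨ cong (k *_) (embed-off j i i i≢j) ⟩
    k * 0ℤ          ≡⟨ *-zeroʳ k ⟩
    0ℤ              ∎)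
    where open ≡-mod-Reasoning (modulus i i)

  embed-injective : ∀ {i j} → embed i ≈ embed j → i ≡ j
  embed-injective {i} {j} i≈j with i ≟ j
  ... | yes i≡j = i≡j
  ... | no  i≢j = ⊥-elim (embed-∉ i≢j (1ℤ , ≈-trans i≈j (≈-sym (identityʳ (embed j)))))

  adjacent⇒≢ : ∀ {i j} → adj i j ≡ true → i ≢ j
  adjacent⇒≢ {i} i∼j refl with trans (sym i∼j) (irrefl i)
  ... | ()

  nonadjacent⇒¬cyclic : ∀ {i j} → i ≢ j → adj i j ≡ false → ¬ CyclicGen2 (embed i) (embed j)
  nonadjacent⇒¬cyclic {i} {j} i≢j i≁j (g , ((a , i≈gᵃ) , (b , j≈gᵇ)) , _) =
    1≢0-mod-sylvester (pairIndexℕ i j) (standard-basis-not-cyclic a b (g i j) (g j i) 1≡ag 0≡bg 1≡bg′)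
    where
    1≡ag : 1ℤ ≡ a * g i j [mod modulus i j ]
    1≡ag = subst (_≡ a * g i j [mod modulus i j ]) (embed-nonadjacent i≁j) (≈pow⇒≡*-mod g a i≈gᵃ i j)
    0≡bg : 0ℤ ≡ b * g i j [mod modulus i j ]
    0≡bg = subst (_≡ b * g i j [mod modulus i j ]) (embed-off j i j i≢j) (≈pow⇒≡*-mod g b j≈gᵇ i j)
    1≡bg′ : 1ℤ ≡ b * g j i [mod modulus i j ]
    1≡bg′ = subst₂ (λ x m → x ≡ b * g j i [mod m ])
      (embed-nonadjacent (trans (adj-sym j i) i≁j)) (modulus-sym j i) (≈pow⇒≡*-mod g b j≈gᵇ j i)

  supports-disjoint : ∀ {i j q k} → adj i j ≡ true → adj i q ≡ false → adj j k ≡ false →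
    pairIndexℕ i q ≢ pairIndexℕ j k
  supports-disjoint {i} {j} {q} {k} i∼j i≁q j≁k eq with pairIndex-injective i q j k (toℕ-injective eq)
  ... | inj₁ (i≡j , _)   = adjacent⇒≢ i∼j i≡j
  ... | inj₂ (_ , refl) with trans (sym i∼j) i≁q
  ...   | ()

  coefficientFactor : Bool → ℕ → ℤ
  coefficientFactor true  _ = 1ℤ
  coefficientFactor false t = idempotent t (N ℕ.* N)

  coefficient : Fin N → ℤ
  coefficient j = ∏ λ k → coefficientFactor (adj j k) (pairIndexℕ j k)

  coefficient≡0 : ∀ {j q} → adj j q ≡ false → coefficient j ≡ 0ℤ [mod modulus j q ]
  coefficient≡0 {j} {q} j≁q = ∏≡0-mod _ q
    (subst (λ b → coefficientFactor b (pairIndexℕ j q) ≡ 0ℤ [mod modulus j q ])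
      (sym j≁q) (idempotent≡0 (pairIndexℕ j q) (N ℕ.* N)))

  coefficient≡1 : ∀ {i j q} → adj i j ≡ true → adj i q ≡ false → coefficient j ≡ 1ℤ [mod modulus i q ]
  coefficient≡1 {i} {j} {q} i∼j i≁q = ∏≡1-mod _ factor≡1
    where
    factor≡1 : ∀ k → coefficientFactor (adj j k) (pairIndexℕ j k) ≡ 1ℤ [mod modulus i q ]
    factor≡1 k with adj j k in adj≡
    ... | true  = ≡-mod-refl
    ... | false = idempotent≡1 (pairIndexℕ j k) (N ℕ.* N) (supports-disjoint i∼j i≁q adj≡)
      (ℕ.≤-trans (ℕ.<⇒≤ (toℕ<n (pairIndex i q))) (ℕ.m≤n+m (N ℕ.* N) (pairIndexℕ j k)))

  embed≡coefficient*sum : ∀ {i j} → adj i j ≡ true → ∀ p q →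
    embed i p q ≡ coefficient j * (embed i p q + embed j p q) [mod modulus p q ]
  embed≡coefficient*sum {i} {j} i∼j p q with i ≟ p | j ≟ p
  ... | yes refl | _ rewrite embed-row i q | embed-off j i q (adjacent⇒≢ i∼j) with adj i q in adj≡
  ...   | true  = ≡-mod-reflexive (sym (*-zeroʳ (coefficient j)))
  ...   | false = ≡-mod-sym (≡-mod-trans (≡-mod-reflexive (*-identityʳ (coefficient j))) (coefficient≡1 i∼j adj≡))
  embed≡coefficient*sum {i} {j} i∼j p q | no i≢p | yes refl
    rewrite embed-off i j q (i≢p ∘ sym) | embed-row j q with adj j q in adj≡
  ...   | true  = ≡-mod-reflexive (sym (*-zeroʳ (coefficient j)))
  ...   | false = ≡-mod-sym (≡-mod-trans (≡-mod-reflexive (*-identityʳ (coefficient j))) (coefficient≡0 adj≡))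
  embed≡coefficient*sum {i} {j} i∼j p q | no i≢p | no j≢p
    rewrite embed-off i p q (i≢p ∘ sym) | embed-off j p q (j≢p ∘ sym) =
      ≡-mod-reflexive (sym (*-zeroʳ (coefficient j)))

  adjacent⇒cyclic : ∀ {i j} → adj i j ≡ true → CyclicGen2 (embed i) (embed j)
  adjacent⇒cyclic {i} {j} i∼j =
    embed i ∙ embed j , (i∈⟨i+j⟩ , j∈⟨i+j⟩)
                      , (1ℤ , 1ℤ , ∙-cong (≈-sym (identityʳ (embed i))) (≈-sym (identityʳ (embed j))))
    where
    i∈⟨i+j⟩ : InCyclic (embed i) (embed i ∙ embed j)
    i∈⟨i+j⟩ = coefficient j ,
      ≡*-mod⇒≈pow (embed i ∙ embed j) (coefficient j) (embed≡coefficient*sum i∼j)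
    j∈⟨i+j⟩ : InCyclic (embed j) (embed i ∙ embed j)
    j∈⟨i+j⟩ = coefficient i , ≡*-mod⇒≈pow (embed i ∙ embed j) (coefficient i) λ p q → ≡-mod-trans
      (embed≡coefficient*sum (trans (adj-sym j i) i∼j) p q)
      (≡-mod-reflexive (cong (coefficient i *_) (+-comm (embed j p q) (embed i p q))))

  adjacent⇒DAdj : ∀ {i j} → adj i j ≡ true → DAdj (embed i) (embed j)
  adjacent⇒DAdj i∼j =
    i≢j ∘ embed-injective , adjacent⇒cyclic i∼j , embed-∉ i≢j , embed-∉ (i≢j ∘ sym)
    where i≢j = adjacent⇒≢ i∼j

  DAdj⇒adjacent : ∀ {i j} → DAdj (embed i) (embed j) → adj i j ≡ true
  DAdj⇒adjacent {i} {j} (i≉j , cyclic , _) with adj i j in adj≡ | i ≟ j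
  ... | true  | _        = refl
  ... | false | yes refl = ⊥-elim (i≉j ≈-refl)
  ... | false | no  i≢j  = ⊥-elim (nonadjacent⇒¬cyclic i≢j adj≡ cyclic)

cone : ∀ {n} → SimpleGraph n → SimpleGraph (suc n)
cone {n} Γ = record { adj = adj′ ; sym = sym′ ; irrefl = irrefl′ }
  where
  open SimpleGraph Γ renaming (sym to adj-sym)
  adj′ : Fin (suc n) → Fin (suc n) → Bool
  adj′ zero    zero    = false
  adj′ zero    (suc j) = true
  adj′ (suc i) zero    = true
  adj′ (suc i) (suc j) = adj i j
  sym′ : ∀ i j → adj′ i j ≡ adj′ j i
  sym′ zero    zero    = refl
  sym′ zero    (suc j) = refl
  sym′ (suc i) zero    = refl
  sym′ (suc i) (suc j) = adj-sym i j
  irrefl′ : ∀ i → adj′ i i ≡ false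
  irrefl′ zero    = refl
  irrefl′ (suc i) = irrefl i

theorem2p9 : (n : ℕ) (Γ : SimpleGraph n) →
    Σ (FiniteAbelianGroup 0ℓ 0ℓ) λ G →
      InducedSubgraphOfD Γ (FiniteAbelianGroup.abGroup G)
theorem2p9 n Γ =
  group , embed ∘ suc
        , (λ i j → suc-injective ∘ embed-injective)
        , (λ i → embed zero , adjacent⇒DAdj refl)
        , (λ i j → mk⇔ adjacent⇒DAdj DAdj⇒adjacent)
  where open DifferenceEmbedding (cone Γ)
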